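{- Let $T(\mathcal{M})$ be the symmetry type graph of a maniplex $\mathcal{M}$. If $u,v,w$ are pairwise distinct vertices of $T(\mathcal{M})$ such that $T(\mathcal{M})$ has an edge of colour $i$ joining $u$ and $v$ and an edge of colour $j$ joining $v$ and $w$, with $|i-j|\ge2$, then the connected component containing $v$ of the subgraph of $T(\mathcal{M})$ spanned by all its vertices and its edges and semi-edges of colours $i$ and $j$ has exactly four vertices.
   Context: A maniplex is given by a connected simple graph (flag graph), whose vertices are called flags, with a proper edge-colouring by colours $\{0,\dots,m\}$ in which each colour class is a perfect matching, such that for colours $i,j$ with $|i-j|\ge2$ each component of the subgraph spanned by colours $i,j$ is a 4-cycle. Automorphisms are colour-preserving graph automorphisms. The symmetry type graph $T(\mathcal{M})$ is the pregraph whose vertices are the $\mathrm{Aut}(\mathcal{M})$-orbits of flags, with an edge of colour $a$ between distinct orbits $B,C$ iff some flag of $B$ is $a$-adjacent to a flag of $C$, and a semi-edge of colour $a$ at $B$ iff some flag of $B$ is $a$-adjacent to a flag of $B$; each vertex carries exactly one edge or semi-edge of each colour. -}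

module Defs where

open import Data.Nat using (ℕ; suc; _≤_; ∣_-_∣)
open import Data.Fin using (toℕ)
open import Data.Fin using (Fin)
open import Data.List using (List; foldr)
open import Data.Product using (Σ; Σ-syntax; ∃; ∃-syntax; _×_)
open import Data.Sum using (_⊎_)
open import Relation.Nullary using (¬_)
open import Relation.Binary.PropositionalEquality using (_≡_)
open import Relation.Binary.Construct.Closure.ReflexiveTransitive using (Star)

applyWord : {F : Set} {n : ℕ} → (Fin n → F → F) → List (Fin n) → F → F
applyWord r w x = foldr r x w

-- A maniplex of rank with colours {0,…,m}: flags F, and for each colour a
-- the a-adjacency given by the perfect matching x ↦ r a x.
record IsManiplex (m : ℕ) (F : Set) (r : Fin (suc m) → F → F) : Set where
  field
    -- each colour class is a perfect matching (involution without fixed points,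
    -- fixed points would be loops, excluded since the graph is simple)
    invol      : ∀ a x → r a (r a x) ≡ x
    noLoop     : ∀ a x → ¬ (r a x ≡ x)
    -- simple graph with a proper edge colouring: distinct colours give
    -- distinct neighbours (no parallel edges)
    simple     : ∀ a b x → ¬ (a ≡ b) → ¬ (r a x ≡ r b x)
    -- for |i - j| ≥ 2 each {i,j}-component is a 4-cycle: x, r i x,
    -- r j (r i x), r i (r j (r i x)) and back to x by colour j
    fourCycle  : ∀ i j x → 2 ≤ ∣ toℕ i - toℕ j ∣ →
                 r j (r i (r j (r i x))) ≡ x
    connected  : ∀ x y → ∃[ w ] applyWord r w x ≡ y

record Aut {m : ℕ} {F : Set} (r : Fin (suc m) → F → F) : Set where
  field
    to      : F → F
    from    : F → F
    to-from : ∀ x → to (from x) ≡ x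
    from-to : ∀ x → from (to x) ≡ x
    commute : ∀ a x → to (r a x) ≡ r a (to x)

-- flags in the same Aut-orbit (vertices of the symmetry type graph are
-- represented by flags, equal as vertices iff SameOrbit)
SameOrbit : {m : ℕ} {F : Set} (r : Fin (suc m) → F → F) → F → F → Set
SameOrbit r x y = Σ[ φ ∈ Aut r ] Aut.to φ x ≡ y

-- the symmetry type graph has an edge or semi-edge of colour a between the
-- orbits of x and y: some flag of orbit(x) is a-adjacent to some flag of orbit(y)
TAdj : {m : ℕ} {F : Set} (r : Fin (suc m) → F → F) → Fin (suc m) → F → F → Set
TAdj r a x y = ∃[ b ] ∃[ c ] (SameOrbit r x b × SameOrbit r y c × r a b ≡ c)

-- an edge (not a semi-edge) of colour a joining the distinct vertices orbit(x), orbit(y)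
TEdge : {m : ℕ} {F : Set} (r : Fin (suc m) → F → F) → Fin (suc m) → F → F → Set
TEdge r a x y = ¬ SameOrbit r x y × TAdj r a x y

-- orbit(y) lies in the connected component of orbit(x) in the subgraph of
-- T(M) spanned by all vertices and the edges/semi-edges of colours i and j
ReachIJ : {m : ℕ} {F : Set} (r : Fin (suc m) → F → F) → Fin (suc m) → Fin (suc m) → F → F → Set
ReachIJ r i j = Star (λ x y → TAdj r i x y ⊎ TAdj r j x y)

ComponentHasFour : {m : ℕ} {F : Set} (r : Fin (suc m) → F → F) → Fin (suc m) → Fin (suc m) → F → Set
ComponentHasFour r i j v =
  Σ[ y₀ ∈ _ ] Σ[ y₁ ∈ _ ] Σ[ y₂ ∈ _ ] Σ[ y₃ ∈ _ ]
    ( (ReachIJ r i j v y₀ × ReachIJ r i j v y₁ × ReachIJ r i j v y₂ × ReachIJ r i j v y₃)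
    × (¬ SameOrbit r y₀ y₁ × ¬ SameOrbit r y₀ y₂ × ¬ SameOrbit r y₀ y₃
       × ¬ SameOrbit r y₁ y₂ × ¬ SameOrbit r y₁ y₃ × ¬ SameOrbit r y₂ y₃)
    × (∀ y → ReachIJ r i j v y →
         SameOrbit r y y₀ ⊎ SameOrbit r y y₁ ⊎ SameOrbit r y y₂ ⊎ SameOrbit r y y₃) )

-- Representing the vertex v of T(M) by the flag v itself, the edges of colours i and j
-- at v are realised at v: u is the orbit of r i v and w that of r j v.  Because
-- i and j commute, the {i,j}-component of v in the flag graph is the square
-- v, r i v, r j v, r i (r j v), and the {i,j}-component of v in T(M) consists of
-- the orbits of these four flags.  The orbits of the first three are u, v, w, and
-- the fourth orbit differs from each of them: an automorphism carrying it to one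
-- of them would, after moving along colour i or j, identify two of u, v, w.
module Submission where

open import Defs
open import Data.Nat using (ℕ; suc; _≤_; ∣_-_∣)
open import Data.Fin using (Fin; toℕ)
open import Data.Product using (_×_; _,_; Σ-syntax)
open import Data.Sum using (_⊎_; inj₁; inj₂)
open import Function using (_∘_)
open import Relation.Nullary using (¬_)
open import Relation.Binary.PropositionalEquality
  using (_≡_; refl; sym; trans; cong; subst; module ≡-Reasoning)
open import Relation.Binary.Construct.Closure.ReflexiveTransitive using (ε; _◅_)

module _ {m : ℕ} {F : Set} {r : Fin (suc m) → F → F} where

  Aut-id : Aut r
  Aut-id = record
    { to = λ x → x ; from = λ x → x
    ; to-from = λ _ → refl ; from-to = λ _ → refl ; commute = λ _ _ → refl }

  Aut-inverse : Aut r → Aut r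
  Aut-inverse φ = record
    { to = from ; from = to ; to-from = from-to ; from-to = to-from
    ; commute = from-commute }
    where
    open Aut φ
    open ≡-Reasoning
    from-commute : ∀ a x → from (r a x) ≡ r a (from x)
    from-commute a x = begin
      from (r a x)               ≡⟨ cong (from ∘ r a) (sym (to-from x)) ⟩
      from (r a (to (from x)))   ≡⟨ cong from (sym (commute a (from x))) ⟩
      from (to (r a (from x)))   ≡⟨ from-to (r a (from x)) ⟩
      r a (from x)               ∎

  Aut-compose : Aut r → Aut r → Aut r
  Aut-compose φ ψ = record
    { to = Aut.to ψ ∘ Aut.to φ
    ; from = Aut.from φ ∘ Aut.from ψ
    ; to-from = λ x → trans (cong (Aut.to ψ) (Aut.to-from φ (Aut.from ψ x))) (Aut.to-from ψ x)
    ; from-to = λ x → trans (cong (Aut.from φ) (Aut.from-to ψ (Aut.to φ x))) (Aut.from-to φ x)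
    ; commute = λ a x → trans (cong (Aut.to ψ) (Aut.commute φ a x)) (Aut.commute ψ a (Aut.to φ x)) }

  SameOrbit-refl : ∀ {x} → SameOrbit r x x
  SameOrbit-refl = Aut-id , refl

  SameOrbit-sym : ∀ {x y} → SameOrbit r x y → SameOrbit r y x
  SameOrbit-sym {x} (φ , refl) = Aut-inverse φ , Aut.from-to φ x

  SameOrbit-trans : ∀ {x y z} → SameOrbit r x y → SameOrbit r y z → SameOrbit r x z
  SameOrbit-trans (φ , refl) (ψ , refl) = Aut-compose φ ψ , refl

  SameOrbit-cong : ∀ a {x y} → SameOrbit r x y → SameOrbit r (r a x) (r a y)
  SameOrbit-cong a {x} (φ , refl) = φ , Aut.commute φ a x

  TAdj-adjacent : ∀ a x → TAdj r a x (r a x)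
  TAdj-adjacent a x = x , r a x , SameOrbit-refl , SameOrbit-refl , refl

  TAdj-transport : ∀ {a y y′ x} → TAdj r a y y′ → SameOrbit r y x → SameOrbit r y′ (r a x)
  TAdj-transport {a} (b , c , y≈b , y′≈c , rab≡c) y≈x =
    SameOrbit-trans y′≈c
      (subst (λ c′ → SameOrbit r c′ _) rab≡c
        (SameOrbit-cong a (SameOrbit-trans (SameOrbit-sym y≈b) y≈x)))

  OrbitMeets : (F → Set) → F → Set
  OrbitMeets P y = Σ[ t ∈ F ] P t × SameOrbit r y t

  ReachIJ-preserves-OrbitMeets :
    ∀ {P : F → Set} {i j y y′} →
    (∀ {t} → P t → P (r i t)) → (∀ {t} → P t → P (r j t)) →
    ReachIJ r i j y y′ → OrbitMeets P y → OrbitMeets P y′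
  ReachIJ-preserves-OrbitMeets closedᵢ closedⱼ ε meets = meets
  ReachIJ-preserves-OrbitMeets closedᵢ closedⱼ (inj₁ adj ◅ path) (t , Pt , y≈t) =
    ReachIJ-preserves-OrbitMeets closedᵢ closedⱼ path
      (_ , closedᵢ Pt , TAdj-transport adj y≈t)
  ReachIJ-preserves-OrbitMeets closedᵢ closedⱼ (inj₂ adj ◅ path) (t , Pt , y≈t) =
    ReachIJ-preserves-OrbitMeets closedᵢ closedⱼ path
      (_ , closedⱼ Pt , TAdj-transport adj y≈t)

module _ {m : ℕ} {F : Set} {r : Fin (suc m) → F → F} (M : IsManiplex m F r) where

  open IsManiplex M

  TAdj-sym : ∀ {a x y} → TAdj r a x y → TAdj r a y x
  TAdj-sym {a} (b , c , x≈b , y≈c , rab≡c) =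
    c , b , y≈c , x≈b , trans (cong (r a) (sym rab≡c)) (invol a b)

  SameOrbit-flip : ∀ a {x y} → SameOrbit r x (r a y) → SameOrbit r (r a x) y
  SameOrbit-flip a {y = y} x≈ray = subst (SameOrbit r _) (invol a y) (SameOrbit-cong a x≈ray)

  SameOrbit-cancel : ∀ a {x y} → SameOrbit r (r a x) (r a y) → SameOrbit r x y
  SameOrbit-cancel a {x} rax≈ray =
    subst (λ x′ → SameOrbit r x′ _) (invol a x) (SameOrbit-flip a rax≈ray)

  module _ {i j : Fin (suc m)} (far : 2 ≤ ∣ toℕ i - toℕ j ∣) where

    r-comm : ∀ x → r i (r j x) ≡ r j (r i x)
    r-comm x = sym (begin
      r j (r i x)                              ≡⟨ sym (invol i _) ⟩
      r i (r i (r j (r i x)))                  ≡⟨ cong (r i) (sym (invol j _)) ⟩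
      r i (r j (r j (r i (r j (r i x)))))      ≡⟨ cong (r i ∘ r j) (fourCycle i j x far) ⟩
      r i (r j x)                              ∎)
      where open ≡-Reasoning

    InSquare : F → F → Set
    InSquare x t = t ≡ x ⊎ t ≡ r i x ⊎ t ≡ r j x ⊎ t ≡ r i (r j x)

    InSquare-closedᵢ : ∀ {x t} → InSquare x t → InSquare x (r i t)
    InSquare-closedᵢ (inj₁ refl)                 = inj₂ (inj₁ refl)
    InSquare-closedᵢ (inj₂ (inj₁ refl))          = inj₁ (invol i _)
    InSquare-closedᵢ (inj₂ (inj₂ (inj₁ refl)))   = inj₂ (inj₂ (inj₂ refl))
    InSquare-closedᵢ (inj₂ (inj₂ (inj₂ refl)))   = inj₂ (inj₂ (inj₁ (invol i _)))

    InSquare-closedⱼ : ∀ {x t} → InSquare x t → InSquare x (r j t)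
    InSquare-closedⱼ (inj₁ refl)                 = inj₂ (inj₂ (inj₁ refl))
    InSquare-closedⱼ (inj₂ (inj₁ refl))          = inj₂ (inj₂ (inj₂ (sym (r-comm _))))
    InSquare-closedⱼ (inj₂ (inj₂ (inj₁ refl)))   = inj₁ (invol j _)
    InSquare-closedⱼ (inj₂ (inj₂ (inj₂ refl)))   =
      inj₂ (inj₁ (trans (sym (r-comm _)) (cong (r i) (invol j _))))

    ReachIJ⇒SameOrbit-square :
      ∀ x y → ReachIJ r i j x y →
      SameOrbit r y x ⊎ SameOrbit r y (r i x) ⊎ SameOrbit r y (r j x) ⊎ SameOrbit r y (r i (r j x))
    ReachIJ⇒SameOrbit-square x y path
      with ReachIJ-preserves-OrbitMeets {P = InSquare x} InSquare-closedᵢ InSquare-closedⱼ path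
             (x , inj₁ refl , SameOrbit-refl)
    ... | _ , inj₁ refl               , y≈t = inj₁ y≈t
    ... | _ , inj₂ (inj₁ refl)        , y≈t = inj₂ (inj₁ y≈t)
    ... | _ , inj₂ (inj₂ (inj₁ refl)) , y≈t = inj₂ (inj₂ (inj₁ y≈t))
    ... | _ , inj₂ (inj₂ (inj₂ refl)) , y≈t = inj₂ (inj₂ (inj₂ y≈t))

lemma3p3 : (m : ℕ) (F : Set) (r : Fin (suc m) → F → F) → IsManiplex m F r →
           (u v w : F) (i j : Fin (suc m)) →
           ¬ SameOrbit r u v → ¬ SameOrbit r v w → ¬ SameOrbit r u w →
           TEdge r i u v → TEdge r j v w → 2 ≤ ∣ toℕ i - toℕ j ∣ →
           ComponentHasFour r i j v
lemma3p3 m F r M u v w i j u≉v v≉w u≉w (_ , uv) (_ , vw) far =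
  v , r i v , r j v , r i (r j v) ,
  (ε , inj₁ (TAdj-adjacent i v) ◅ ε , inj₂ (TAdj-adjacent j v) ◅ ε ,
   inj₂ (TAdj-adjacent j v) ◅ inj₁ (TAdj-adjacent i (r j v)) ◅ ε) ,
  (v≉riv , v≉rjv , v≉rirjv , riv≉rjv , riv≉rirjv , rjv≉rirjv) ,
  ReachIJ⇒SameOrbit-square M far v
  where
  u≈riv : SameOrbit r u (r i v)
  u≈riv = TAdj-transport (TAdj-sym M uv) SameOrbit-refl
  w≈rjv : SameOrbit r w (r j v)
  w≈rjv = TAdj-transport vw SameOrbit-refl
  v≉riv : ¬ SameOrbit r v (r i v)
  v≉riv v≈riv = u≉v (SameOrbit-trans u≈riv (SameOrbit-sym v≈riv))
  v≉rjv : ¬ SameOrbit r v (r j v)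
  v≉rjv v≈rjv = v≉w (SameOrbit-trans v≈rjv (SameOrbit-sym w≈rjv))
  riv≉rjv : ¬ SameOrbit r (r i v) (r j v)
  riv≉rjv riv≈rjv = u≉w (SameOrbit-trans u≈riv (SameOrbit-trans riv≈rjv (SameOrbit-sym w≈rjv)))
  v≉rirjv : ¬ SameOrbit r v (r i (r j v))
  v≉rirjv = riv≉rjv ∘ SameOrbit-flip M i
  riv≉rirjv : ¬ SameOrbit r (r i v) (r i (r j v))
  riv≉rirjv = v≉rjv ∘ SameOrbit-cancel M i
  rjv≉rirjv : ¬ SameOrbit r (r j v) (r i (r j v))
  rjv≉rirjv = v≉riv ∘ SameOrbit-cancel M j ∘ subst (SameOrbit r (r j v)) (r-comm M far v)
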